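{- Let $n\ge 1$ and let $\pi\in\mathcal D^1_{2n}(2413,3142)$ with last entry $2k-1$ (for some $1\le k\le n$). Then every entry of $\pi$ lying strictly between the entry $2k$ and the last entry $2k-1$ is less than $2k-1$.
   Context: A Dumont permutation of the first kind of length $2n$ is a permutation $\pi=\pi(1)\cdots\pi(2n)$ of $\{1,\dots,2n\}$ such that for every $i$: if $\pi(i)$ is even then $i<2n$ and $\pi(i)>\pi(i+1)$; if $\pi(i)$ is odd then $i=2n$ or $\pi(i)<\pi(i+1)$. (In particular the last entry is odd and the entry $2k$ appears before it.) $\mathcal D^1_{2n}(2413,3142)$ denotes the set of such permutations that contain no subsequence order-isomorphic to $2413$ or to $3142$. -}

module Defs where

open import Data.Nat using (ℕ; zero; suc; _+_; _*_; _∸_; _≤_; _<_)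
open import Data.Fin using (Fin; toℕ)
open import Data.Product using (Σ; ∃; _×_)
open import Data.Sum using (_⊎_)
open import Relation.Binary.PropositionalEquality using (_≡_)
open import Relation.Nullary using (¬_)

Even : ℕ → Set
Even x = Σ ℕ λ t → x ≡ 2 * t

Odd : ℕ → Set
Odd x = Σ ℕ λ t → x ≡ suc (2 * t)

IsPerm : (m : ℕ) → (Fin m → ℕ) → Set
IsPerm m π = (∀ i → 1 ≤ π i × π i ≤ m) × (∀ i j → π i ≡ π j → i ≡ j)

IsDumont1 : (m : ℕ) → (Fin m → ℕ) → Set
IsDumont1 m π =
  (∀ i → Even (π i) → Σ (Fin m) λ j → toℕ j ≡ suc (toℕ i) × π j < π i) ×
  (∀ i → Odd (π i) → toℕ i ≡ m ∸ 1 ⊎ Σ (Fin m) λ j → toℕ j ≡ suc (toℕ i) × π i < π j)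

Contains2413 : (m : ℕ) → (Fin m → ℕ) → Set
Contains2413 m π = Σ (Fin m) λ a → Σ (Fin m) λ b → Σ (Fin m) λ c → Σ (Fin m) λ d →
  (toℕ a < toℕ b × toℕ b < toℕ c × toℕ c < toℕ d) ×
  (π c < π a × π a < π d × π d < π b)

Contains3142 : (m : ℕ) → (Fin m → ℕ) → Set
Contains3142 m π = Σ (Fin m) λ a → Σ (Fin m) λ b → Σ (Fin m) λ c → Σ (Fin m) λ d →
  (toℕ a < toℕ b × toℕ b < toℕ c × toℕ c < toℕ d) ×
  (π b < π d × π d < π a × π a < π c)

InD1 : (n : ℕ) → (Fin (2 * n) → ℕ) → Set
InD1 n π = IsPerm (2 * n) π × IsDumont1 (2 * n) π ×
  ¬ Contains2413 (2 * n) π × ¬ Contains3142 (2 * n) π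

module Submission where

open import Defs
open import Data.Nat using (ℕ; suc; _*_; _∸_; _≤_; _<_)
open import Data.Nat.Properties using (<⇒≢; ≤∧≢⇒<; <-cmp; <-trans; ≤-<-trans; m≤n⇒m<n∨m≡n; ≤-pred; n<1+n)
open import Data.Fin using (Fin; toℕ)
open import Data.Fin.Properties using (toℕ-injective)
open import Data.Product using (_,_)
open import Data.Sum using (inj₁; inj₂)
open import Relation.Binary using (tri<; tri≈; tri>)
open import Relation.Binary.PropositionalEquality using (_≡_; _≢_; sym; trans; cong; subst)
open import Relation.Nullary using (¬_; contradiction)

-- The entry 2k is a descent top (π(p) > π(p+1)); by injectivity π(p+1) is not 2k − 1
-- either, so π(p+1) < 2k − 1. Any later entry above 2k − 1 before the end would then
-- be above 2k, and p, p+1, i, last would form a 3142.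

module _ {m : ℕ} {π : Fin m → ℕ} (injective : ∀ a b → π a ≡ π b → a ≡ b) where

  <⇒image-≢ : ∀ {a b} → toℕ a < toℕ b → π a ≢ π b
  <⇒image-≢ a<b πa≡πb = <⇒≢ a<b (cong toℕ (injective _ _ πa≡πb))

  <-suc-image⇒< : ∀ {a b} {v} → π b ≡ v → π a < suc v → toℕ a < toℕ b → π a < v
  <-suc-image⇒< πb≡v πa<1+v a<b =
    ≤∧≢⇒< (≤-pred πa<1+v) (λ πa≡v → <⇒image-≢ a<b (trans πa≡v (sym πb≡v)))

  3142-free⇒below-last :
    ¬ Contains3142 m π → ∀ {p j i l} → π p ≡ suc (π l) →
    toℕ p < toℕ j → π j < π l → toℕ j ≤ toℕ i → toℕ i < toℕ l → π i < π l
  3142-free⇒below-last no3142 {p} {j} {i} {l} πp≡1+πl p<j πj<πl j≤i i<l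
    with m≤n⇒m<n∨m≡n j≤i
  ... | inj₂ j≡i rewrite toℕ-injective j≡i = πj<πl
  ... | inj₁ j<i with <-cmp (π i) (π l)
  ...   | tri< πi<πl _ _ = πi<πl
  ...   | tri≈ _ πi≡πl _ = contradiction πi≡πl (<⇒image-≢ i<l)
  ...   | tri> _ _ πl<πi = contradiction
           (p , j , i , l , (p<j , j<i , i<l) ,
            (πj<πl , subst (π l <_) (sym πp≡1+πl) (n<1+n (π l)) , πp<πi))
           no3142
    where
    p<i : toℕ p < toℕ i
    p<i = <-trans p<j j<i
    πp<πi : π p < π i
    πp<πi = ≤∧≢⇒< (subst (_≤ π i) (sym πp≡1+πl) πl<πi) (<⇒image-≢ p<i)

lemma1 : (n : ℕ) → 1 ≤ n → (π : Fin (2 * n) → ℕ) → InD1 n π →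
    (k : ℕ) → 1 ≤ k → k ≤ n →
    (last : Fin (2 * n)) → toℕ last ≡ 2 * n ∸ 1 → π last ≡ 2 * k ∸ 1 →
    (p : Fin (2 * n)) → π p ≡ 2 * k →
    (i : Fin (2 * n)) → toℕ p < toℕ i → toℕ i < toℕ last →
    π i < 2 * k ∸ 1
lemma1 n _ π ((_ , injective) , (evenDescends , _) , _ , no3142) (suc k) _ _ last _ πlast p πp i p<i i<last
  with evenDescends p (suc k , πp)
... | j , j≡1+p , πj<πp =
  subst (π i <_) πlast
    (3142-free⇒below-last injective no3142 πp≡1+πlast p<j πj<πlast j≤i i<last)
  where
  -- With k matched as suc k, 2 * k reduces to suc (2 * k ∸ 1), so no arithmetic is needed.
  πp≡1+πlast : π p ≡ suc (π last)
  πp≡1+πlast = trans πp (cong suc (sym πlast))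
  p<j : toℕ p < toℕ j
  p<j = subst (toℕ p <_) (sym j≡1+p) (n<1+n (toℕ p))
  j≤i : toℕ j ≤ toℕ i
  j≤i = subst (_≤ toℕ i) (sym j≡1+p) p<i
  πj<πlast : π j < π last
  πj<πlast = subst (π j <_) (sym πlast)
    (<-suc-image⇒< injective πlast (subst (π j <_) πp πj<πp) (≤-<-trans j≤i i<last))
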